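{- For all closed terms $P$ and $Q$ over $\Sigma_{CP}(A)$: if $\mathrm{CP}_{st}\vdash P=Q$ then $P=_{st}Q$.
   Context: Fix a finite non-empty set $A$ of atomic propositions. Closed terms are built from $T$, $F$, $a\in A$ by conditional composition $P\triangleleft Q\triangleright R$. $\mathrm{CP}_{st}$ consists of (CP1) $x\triangleleft T\triangleright y=x$, (CP2) $x\triangleleft F\triangleright y=y$, (CP3) $T\triangleleft x\triangleright F=x$, (CP4) $x\triangleleft(y\triangleleft z\triangleright u)\triangleright v=(x\triangleleft y\triangleright v)\triangleleft z\triangleright(x\triangleleft u\triangleright v)$, (CPstat) $(x\triangleleft y\triangleright z)\triangleleft u\triangleright v=(x\triangleleft u\triangleright v)\triangleleft y\triangleright(z\triangleleft u\triangleright v)$, (CPcontr) $(x\triangleleft y\triangleright z)\triangleleft y\triangleright u=x\triangleleft y\triangleright u$; $\vdash$ is equational derivability. A reactive valuation algebra (RVA) is a set $RV$ with elements $T_{RV},F_{RV}$ and for each $a\in A$ functions $y_a:RV\to\{T,F\}$, $\partial_a:RV\to RV$ with $y_a(T_{RV})=T$, $y_a(F_{RV})=F$, $\partial_a(T_{RV})=T_{RV}$, $\partial_a(F_{RV})=F_{RV}$. For closed $P$ and $H\in RV$: $T/H=T$, $F/H=F$, $a/H=y_a(H)$, $\partial_T(H)=\partial_F(H)=H$; $(P\triangleleft Q\triangleright R)/H=P/\partial_Q(H)$ and $\partial_{P\triangleleft Q\triangleright R}(H)=\partial_P(\partial_Q(H))$ if $Q/H=T$, and $R/\partial_Q(H)$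 resp. $\partial_R(\partial_Q(H))$ if $Q/H=F$. The variety $st$ (static valuations) is the class of RVAs with $y_a(\partial_b(H))=y_a(H)$ for all $a,b\in A$, $H\in RV$. $P\equiv_{st}Q$ means $P/H=Q/H$ for all RVAs in $st$ and all $H$; $=_{st}$ is the largest congruence (w.r.t. conditional composition) on closed terms contained in $\equiv_{st}$. -}

module Defs where

open import Data.Nat using (ℕ; suc)
open import Data.Fin using (Fin)
open import Data.Bool using (Bool; true; false)
open import Data.Product using (Σ; _×_)
open import Relation.Binary.PropositionalEquality using (_≡_)

Atom : ℕ → Set
Atom n = Fin (suc n)

data Term (n : ℕ) : Set where
  T F  : Term n
  atom : Atom n → Term n
  _◁_▷_ : Term n → Term n → Term n → Term n

-- Equational derivability from CP_st, restricted to closed equations: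
-- the congruence closure of all closed instances of the axioms.
data _⊢st_≈_ (n : ℕ) : Term n → Term n → Set where
  CP1 : ∀ x y → n ⊢st (x ◁ T ▷ y) ≈ x
  CP2 : ∀ x y → n ⊢st (x ◁ F ▷ y) ≈ y
  CP3 : ∀ x → n ⊢st (T ◁ x ▷ F) ≈ x
  CP4 : ∀ x y z u v →
        n ⊢st (x ◁ (y ◁ z ▷ u) ▷ v) ≈ ((x ◁ y ▷ v) ◁ z ▷ (x ◁ u ▷ v))
  CPstat : ∀ x y z u v →
        n ⊢st ((x ◁ y ▷ z) ◁ u ▷ v) ≈ ((x ◁ u ▷ v) ◁ y ▷ (z ◁ u ▷ v))
  CPcontr : ∀ x y z u →
        n ⊢st ((x ◁ y ▷ z) ◁ y ▷ u) ≈ (x ◁ y ▷ u)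
  refl  : ∀ {x} → n ⊢st x ≈ x
  sym   : ∀ {x y} → n ⊢st x ≈ y → n ⊢st y ≈ x
  trans : ∀ {x y z} → n ⊢st x ≈ y → n ⊢st y ≈ z → n ⊢st x ≈ z
  cong  : ∀ {x x' y y' z z'} → n ⊢st x ≈ x' → n ⊢st y ≈ y' → n ⊢st z ≈ z' →
          n ⊢st (x ◁ y ▷ z) ≈ (x' ◁ y' ▷ z')

record RVA (n : ℕ) : Set₁ where
  field
    RV   : Set
    T-RV : RV
    F-RV : RV
    y    : Atom n → RV → Bool
    ∂    : Atom n → RV → RV
    y-T  : ∀ a → y a T-RV ≡ true
    y-F  : ∀ a → y a F-RV ≡ false
    ∂-T  : ∀ a → ∂ a T-RV ≡ T-RV
    ∂-F  : ∀ a → ∂ a F-RV ≡ F-RV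

module _ {n : ℕ} (R : RVA n) where
  open RVA R

  eval  : Term n → RV → Bool
  deriv : Term n → RV → RV

  eval T H = true
  eval F H = false
  eval (atom a) H = y a H
  eval (P ◁ Q ▷ R') H with eval Q H
  ... | true  = eval P (deriv Q H)
  ... | false = eval R' (deriv Q H)

  deriv T H = H
  deriv F H = H
  deriv (atom a) H = ∂ a H
  deriv (P ◁ Q ▷ R') H with eval Q H
  ... | true  = deriv P (deriv Q H)
  ... | false = deriv R' (deriv Q H)

IsStatic : {n : ℕ} → RVA n → Set
IsStatic R = ∀ a b H → y a (∂ b H) ≡ y a H
  where open RVA R

_≡st_ : {n : ℕ} → Term n → Term n → Set₁
_≡st_ {n} P Q = (R : RVA n) → IsStatic R → (H : RVA.RV R) → eval R P H ≡ eval R Q H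

record IsCongruence {n : ℕ} (_∼_ : Term n → Term n → Set₁) : Set₁ where
  field
    ∼-refl  : ∀ {x} → x ∼ x
    ∼-sym   : ∀ {x y} → x ∼ y → y ∼ x
    ∼-trans : ∀ {x y z} → x ∼ y → y ∼ z → x ∼ z
    ∼-cong  : ∀ {x x' y y' z z'} → x ∼ x' → y ∼ y' → z ∼ z' →
              (x ◁ y ▷ z) ∼ (x' ◁ y' ▷ z')

-- =_st : the largest congruence contained in ≡_st.  P =_st Q holds iff P and Q
-- are related by some congruence contained in ≡_st (the union of all such
-- congruences generates a congruence still contained in ≡_st, namely the largest one).
_=st_ : {n : ℕ} → Term n → Term n → Set₂
_=st_ {n} P Q =
  Σ (Term n → Term n → Set₁) λ _∼_ →
    IsCongruence _∼_ × (∀ {x y} → x ∼ y → x ≡st y) × (P ∼ Q)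

-- Over a static valuation algebra a derivative never changes the reply to an
-- atom, so P / H depends only on the Boolean valuation a ↦ y_a(H), and is
-- given there by the truth-table reading of P ◁ Q ▷ R as "if Q then P else R".
-- Hence ≡_st is already a congruence, and every axiom of CP_st is an
-- if-then-else identity on Booleans; so derivability lies inside ≡_st, which
-- is then one of the congruences whose union is =_st.
module Submission where

open import Defs
open import Data.Nat using (ℕ)
open import Data.Bool using (Bool; true; false; if_then_else_)
open import Data.Bool.Properties using (if-float; if-cong; if-cong₂)
open import Data.Product using (_,_)
open import Function using (id)
open import Relation.Binary.PropositionalEquality as ≡ using (_≡_; _≗_)
open ≡.≡-Reasoning

if-then-true-else-false : ∀ b → (if b then true else false) ≡ b
if-then-true-else-false true  = ≡.refl
if-then-true-else-false false = ≡.refl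

if-contract : ∀ {A : Set} b {x y z : A} →
              (if b then (if b then x else y) else z) ≡ (if b then x else z)
if-contract true  = ≡.refl
if-contract false = ≡.refl

module _ {n : ℕ} where

  Valuation : Set
  Valuation = Atom n → Bool

  ⟦_⟧ : Term n → Valuation → Bool
  ⟦ T ⟧         v = true
  ⟦ F ⟧         v = false
  ⟦ atom a ⟧    v = v a
  ⟦ P ◁ Q ▷ R ⟧ v = if ⟦ Q ⟧ v then ⟦ P ⟧ v else ⟦ R ⟧ v

  ⟦⟧-cong : ∀ P {v w : Valuation} → v ≗ w → ⟦ P ⟧ v ≡ ⟦ P ⟧ w
  ⟦⟧-cong T           v≗w = ≡.refl
  ⟦⟧-cong F           v≗w = ≡.refl
  ⟦⟧-cong (atom a)    v≗w = v≗w a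
  ⟦⟧-cong (P ◁ Q ▷ R) v≗w =
    ≡.trans (if-cong (⟦⟧-cong Q v≗w)) (if-cong₂ _ (⟦⟧-cong P v≗w) (⟦⟧-cong R v≗w))

  module Static (R : RVA n) (static : IsStatic R) where
    open RVA R

    valuation : RV → Valuation
    valuation H a = y a H

    valuation-deriv : ∀ P H → valuation (deriv R P H) ≗ valuation H
    valuation-deriv T           H a = ≡.refl
    valuation-deriv F           H a = ≡.refl
    valuation-deriv (atom b)    H a = static a b H
    valuation-deriv (P ◁ Q ▷ S) H a with eval R Q H
    ... | true  = ≡.trans (valuation-deriv P (deriv R Q H) a) (valuation-deriv Q H a)
    ... | false = ≡.trans (valuation-deriv S (deriv R Q H) a) (valuation-deriv Q H a)

    eval≡⟦⟧ : ∀ P H → eval R P H ≡ ⟦ P ⟧ (valuation H)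
    eval≡⟦⟧ T           H = ≡.refl
    eval≡⟦⟧ F           H = ≡.refl
    eval≡⟦⟧ (atom a)    H = ≡.refl
    eval≡⟦⟧ (P ◁ Q ▷ S) H with eval R Q H | eval≡⟦⟧ Q H
    ... | true  | Q≡ rewrite ≡.sym Q≡ =
      ≡.trans (eval≡⟦⟧ P (deriv R Q H)) (⟦⟧-cong P (valuation-deriv Q H))
    ... | false | Q≡ rewrite ≡.sym Q≡ =
      ≡.trans (eval≡⟦⟧ S (deriv R Q H)) (⟦⟧-cong S (valuation-deriv Q H))

    eval-◁ : ∀ P Q S H →
             eval R (P ◁ Q ▷ S) H ≡ (if eval R Q H then eval R P H else eval R S H)
    eval-◁ P Q S H = begin
      eval R (P ◁ Q ▷ S) H
        ≡⟨ eval≡⟦⟧ (P ◁ Q ▷ S) H ⟩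
      (if ⟦ Q ⟧ v then ⟦ P ⟧ v else ⟦ S ⟧ v)
        ≡˘⟨ ≡.trans (if-cong (eval≡⟦⟧ Q H)) (if-cong₂ _ (eval≡⟦⟧ P H) (eval≡⟦⟧ S H)) ⟩
      (if eval R Q H then eval R P H else eval R S H)
        ∎
      where v = valuation H

  -- P ≡st Q unfolds to a Π-type from which P and Q cannot be inferred, hence
  -- the explicit term arguments here and below.
  ⟦⟧-equal⇒≡st : ∀ P Q → (∀ v → ⟦ P ⟧ v ≡ ⟦ Q ⟧ v) → P ≡st Q
  ⟦⟧-equal⇒≡st P Q P≡Q R static H = begin
    eval R P H            ≡⟨ eval≡⟦⟧ P H ⟩
    ⟦ P ⟧ (valuation H)   ≡⟨ P≡Q (valuation H) ⟩
    ⟦ Q ⟧ (valuation H)   ≡˘⟨ eval≡⟦⟧ Q H ⟩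
    eval R Q H            ∎
    where open Static R static

  ≡st-cong : ∀ {P P' Q Q' S S'} → P ≡st P' → Q ≡st Q' → S ≡st S' →
             (P ◁ Q ▷ S) ≡st (P' ◁ Q' ▷ S')
  ≡st-cong {P} {P'} {Q} {Q'} {S} {S'} P≡ Q≡ S≡ R static H = begin
    eval R (P ◁ Q ▷ S) H
      ≡⟨ eval-◁ P Q S H ⟩
    (if eval R Q H then eval R P H else eval R S H)
      ≡⟨ ≡.trans (if-cong (Q≡ R static H)) (if-cong₂ _ (P≡ R static H) (S≡ R static H)) ⟩
    (if eval R Q' H then eval R P' H else eval R S' H)
      ≡˘⟨ eval-◁ P' Q' S' H ⟩
    eval R (P' ◁ Q' ▷ S') H
      ∎
    where open Static R static

  ≡st-isCongruence : IsCongruence (_≡st_ {n})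
  ≡st-isCongruence = record
    { ∼-refl  = λ R static H → ≡.refl
    ; ∼-sym   = λ P≡Q R static H → ≡.sym (P≡Q R static H)
    ; ∼-trans = λ P≡Q Q≡S R static H → ≡.trans (P≡Q R static H) (Q≡S R static H)
    ; ∼-cong  = λ {P} {P'} {Q} {Q'} {S} {S'} → ≡st-cong {P} {P'} {Q} {Q'} {S} {S'}
    }

  ⊢st⇒≡st : ∀ {P Q} → n ⊢st P ≈ Q → P ≡st Q
  ⊢st⇒≡st (CP1 x y) = ⟦⟧-equal⇒≡st (x ◁ T ▷ y) x λ v → ≡.refl
  ⊢st⇒≡st (CP2 x y) = ⟦⟧-equal⇒≡st (x ◁ F ▷ y) y λ v → ≡.refl
  ⊢st⇒≡st (CP3 x)   = ⟦⟧-equal⇒≡st (T ◁ x ▷ F) x λ v →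
    if-then-true-else-false (⟦ x ⟧ v)
  ⊢st⇒≡st (CP4 x y z u w) =
    ⟦⟧-equal⇒≡st (x ◁ (y ◁ z ▷ u) ▷ w) ((x ◁ y ▷ w) ◁ z ▷ (x ◁ u ▷ w)) λ v →
      if-float (λ b → if b then ⟦ x ⟧ v else ⟦ w ⟧ v) (⟦ z ⟧ v)
  ⊢st⇒≡st (CPstat x y z u w) =
    ⟦⟧-equal⇒≡st ((x ◁ y ▷ z) ◁ u ▷ w) ((x ◁ u ▷ w) ◁ y ▷ (z ◁ u ▷ w)) λ v →
      if-float (λ b → if ⟦ u ⟧ v then b else ⟦ w ⟧ v) (⟦ y ⟧ v)
  ⊢st⇒≡st (CPcontr x y z u) =
    ⟦⟧-equal⇒≡st ((x ◁ y ▷ z) ◁ y ▷ u) (x ◁ y ▷ u) λ v → if-contract (⟦ y ⟧ v)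
  ⊢st⇒≡st refl        R static H = ≡.refl
  ⊢st⇒≡st (sym d)     R static H = ≡.sym (⊢st⇒≡st d R static H)
  ⊢st⇒≡st (trans d e) R static H = ≡.trans (⊢st⇒≡st d R static H) (⊢st⇒≡st e R static H)
  ⊢st⇒≡st (cong {P} {P'} {Q} {Q'} {S} {S'} d e f) =
    ≡st-cong {P} {P'} {Q} {Q'} {S} {S'} (⊢st⇒≡st d) (⊢st⇒≡st e) (⊢st⇒≡st f)

mainTheorem9 : (n : ℕ) (P Q : Term n) → n ⊢st P ≈ Q → P =st Q
mainTheorem9 n P Q d = _≡st_ , ≡st-isCongruence , id , ⊢st⇒≡st d
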